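{- Let $G$ be a formula and let $DB^1$ be a compact saturated database for $G$. Then for every saturated database $DB^2$ for $G$, $DB^1\subseteq DB^2$.
   Context: Formulas are built from a countably infinite set $\mathcal{V}$ of propositional variables and $\bot$ using $\land,\lor,\supset$. Let $\mathcal{V}_\bot=\mathcal{V}\cup\{\bot\}$, $\mathcal{L}^{\supset}$ the set of formulas with main connective $\supset$. For a formula $G$, $\mathrm{Sl}(G)$ and $\mathrm{Sr}(G)$ are the smallest subsets of the subformulas of $G$ with: $G\in\mathrm{Sr}(G)$; $A\land B$ or $A\lor B$ in $\mathrm{Sl}(G)$ (resp. $\mathrm{Sr}(G)$) implies $A,B$ in $\mathrm{Sl}(G)$ (resp. $\mathrm{Sr}(G)$); $A\supset B\in\mathrm{Sl}(G)$ implies $B\in\mathrm{Sl}(G)$, $A\in\mathrm{Sr}(G)$; $A\supset B\in\mathrm{Sr}(G)$ implies $B\in\mathrm{Sr}(G)$, $A\in\mathrm{Sl}(G)$. $\mathrm{Cl}(\Gamma)$ is the smallest set containing $\Gamma$ such that if $X,Y\in\mathrm{Cl}(\Gamma)$ and $A$ is any formula then $X\land Y,A\lor X,X\lor A,A\supset X\in\mathrm{Cl}(\Gamma)$. $\mathbf{FRJ}(G)$: let $\bar\Gamma^{At}=\mathrm{Sl}(G)\cap\mathcal V$, $\bar\Gamma^{\supset}=\mathrm{Sl}(G)\cap\mathcal L^{\supset}$, $\bar\Gamma=\bar\Gamma^{At}\cup\bar\Gamma^{\supset}$. Sequents: regular $\Gamma\Rightarrow C$ ($\Gamma\subseteq\bar\Gamma$,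 $C\in\mathrm{Sr}(G)$), irregular $\Sigma;\Theta\rightarrow C$ ($\Sigma\cup\Theta\subseteq\bar\Gamma$, $C\in\mathrm{Sr}(G)$); conclusions always have right formula in $\mathrm{Sr}(G)$. Rules ($F\in\mathcal V_\bot$, $k\in\{1,2\}$): axioms $\bar\Gamma^{At}\setminus\{F\}\Rightarrow F$ and $\emptyset;(\bar\Gamma^{At}\setminus\{F\})\cup\bar\Gamma^{\supset}\rightarrow F$; ($\land$) $\Gamma\Rightarrow A_k/\Gamma\Rightarrow A_1\land A_2$ and $\Sigma;\Theta\rightarrow A_k/\Sigma;\Theta\rightarrow A_1\land A_2$; ($\lor$) $\Sigma_1;\Theta_1\rightarrow C_1$, $\Sigma_2;\Theta_2\rightarrow C_2 / \Sigma_1\cup\Sigma_2;\Theta_1\cap\Theta_2\rightarrow C_1\lor C_2$ if $\Sigma_1\subseteq\Sigma_2\cup\Theta_2$, $\Sigma_2\subseteq\Sigma_1\cup\Theta_1$; ($\supset_\in$) $\Gamma\Rightarrow B/\Gamma\Rightarrow A\supset B$ if $A\in\mathrm{Cl}(\Gamma)$, and $\Sigma;\Theta\cup\Lambda\rightarrow B/\Sigma\cup\Lambda;\Theta\rightarrow A\supset B$ if $\Theta\cap\Lambda=\emptyset$, $A\in\mathrm{Cl}(\Sigma\cup\Lambda)$ and no $\Lambda'\subsetneq\Lambda$ has $A\in\mathrm{Cl}(\Sigma\cup\Lambda')$; ($\supset_{\notin}$) $\Gamma\Rightarrow B/\emptyset;\Theta\rightarrow A\supset B$ if $\Theta\subseteq\mathrm{Cl}(\Gamma)\cap\bar\Gamma$,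 $A\in\mathrm{Cl}(\Gamma)\setminus\mathrm{Cl}(\Theta)$ and every $\Theta'$ with $\Theta\subsetneq\Theta'\subseteq\mathrm{Cl}(\Gamma)\cap\bar\Gamma$ has $A\in\mathrm{Cl}(\Theta')$; join rules with premises $\Sigma_j;\Theta_j\rightarrow A_j$ ($1\le j\le n$, $n\ge1$): let $\Upsilon=\{A_1,\dots,A_n\}$, $\Sigma^{At}=\bigcup_j(\Sigma_j\cap\mathcal V)$, $\Sigma^{\supset}=\bigcup_j(\Sigma_j\cap\mathcal L^{\supset})$, $\Theta^{At}=\bigcap_j(\Theta_j\cap\mathcal V)$, $\Theta^{\supset}=\{Y\supset Z\in\bigcap_j(\Theta_j\cap\mathcal L^{\supset}):Y\in\Upsilon\}$, requiring $\Sigma_i\subseteq\Sigma_j\cup\Theta_j$ ($i\ne j$) and ($Y\supset Z\in\Sigma^{\supset}\Rightarrow Y\in\Upsilon$); ($\bowtie^{At}$) conclusion $\Sigma^{At}\cup(\Theta^{At}\setminus\{F\})\cup\Sigma^{\supset}\cup\Theta^{\supset}\Rightarrow F$, $F\in\mathcal V_\bot\setminus\Sigma^{At}$, where each $Y\in\Upsilon$ has some $Y\supset Z\in\mathrm{Sl}(G)$; ($\bowtie^{\lor}$) conclusion $\Sigma^{At}\cup\Theta^{At}\cup\Sigma^{\supset}\cup\Theta^{\supset}\Rightarrow C_1\lor C_2$, $\{C_1,C_2\}\subseteq\Upsilon$, where each $Y\in\Upsilon$ has some $Y\supset Z\in\mathrm{Sl}(G)$ or $Y\lor Z\in\mathrm{Sr}(G)$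 or $Z\lor Y\in\mathrm{Sr}(G)$. Subsumption: $\sigma_1\sqsubseteq\sigma_2$ iff either $\sigma_1=\Gamma_1\Rightarrow C$, $\sigma_2=\Gamma_2\Rightarrow C$ with $\Gamma_1\subseteq\Gamma_2$, or $\sigma_1=\Sigma;\Theta_1\rightarrow C$, $\sigma_2=\Sigma;\Theta_2\rightarrow C$ with $\Theta_1\subseteq\Theta_2$; $\sigma_1\sqsubset\sigma_2$ means $\sigma_1\sqsubseteq\sigma_2$ and $\sigma_1\ne\sigma_2$. A database for $G$ is a set of $\mathbf{FRJ}(G)$-sequents each derivable in $\mathbf{FRJ}(G)$; it is saturated if for every derivable $\mathbf{FRJ}(G)$-sequent $\sigma$ it contains some $\sigma'$ with $\sigma\sqsubseteq\sigma'$; it is compact if there are no $\sigma,\sigma'$ in it with $\sigma'\sqsubset\sigma$. -}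

module Defs where

open import Data.Nat using (ℕ; suc)
open import Data.Fin using (Fin)
open import Data.Bool using (Bool; true; false; if_then_else_)
open import Data.List using (List; []; _∷_; _++_; deduplicate; length; map; lookup; allFin)
open import Data.Product using (Σ; ∃; ∃-syntax; _×_; _,_)
open import Data.Sum using (_⊎_)
open import Data.Empty renaming (⊥ to Empty)
open import Relation.Nullary using (¬_; yes; no)
open import Relation.Binary.PropositionalEquality using (_≡_; _≢_; refl; cong; cong₂)
open import Relation.Binary.Definitions using (DecidableEquality)
import Data.Nat as ℕ
import Data.Fin.Subset as S
open S using (Subset; inside; outside)

infixr 6 _∧_
infixr 5 _∨_
infixr 4 _⊃_

data Formula : Set where
  var : ℕ → Formula
  ⊥'  : Formula
  _∧_ _∨_ _⊃_ : Formula → Formula → Formula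

_≟F_ : DecidableEquality Formula
var x ≟F var y with x ℕ.≟ y
... | yes refl = yes refl
... | no p = no λ { refl → p refl }
var _ ≟F ⊥' = no λ ()
var _ ≟F (_ ∧ _) = no λ ()
var _ ≟F (_ ∨ _) = no λ ()
var _ ≟F (_ ⊃ _) = no λ ()
⊥' ≟F var _ = no λ ()
⊥' ≟F ⊥' = yes refl
⊥' ≟F (_ ∧ _) = no λ ()
⊥' ≟F (_ ∨ _) = no λ ()
⊥' ≟F (_ ⊃ _) = no λ ()
(_ ∧ _) ≟F var _ = no λ ()
(_ ∧ _) ≟F ⊥' = no λ ()
(a ∧ b) ≟F (c ∧ d) with a ≟F c | b ≟F d
... | yes refl | yes refl = yes refl
... | no p | _ = no λ { refl → p refl }
... | yes _ | no q = no λ { refl → q refl }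
(_ ∧ _) ≟F (_ ∨ _) = no λ ()
(_ ∧ _) ≟F (_ ⊃ _) = no λ ()
(_ ∨ _) ≟F var _ = no λ ()
(_ ∨ _) ≟F ⊥' = no λ ()
(_ ∨ _) ≟F (_ ∧ _) = no λ ()
(a ∨ b) ≟F (c ∨ d) with a ≟F c | b ≟F d
... | yes refl | yes refl = yes refl
... | no p | _ = no λ { refl → p refl }
... | yes _ | no q = no λ { refl → q refl }
(_ ∨ _) ≟F (_ ⊃ _) = no λ ()
(_ ⊃ _) ≟F var _ = no λ ()
(_ ⊃ _) ≟F ⊥' = no λ ()
(_ ⊃ _) ≟F (_ ∧ _) = no λ ()
(_ ⊃ _) ≟F (_ ∨ _) = no λ ()
(a ⊃ b) ≟F (c ⊃ d) with a ≟F c | b ≟F d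
... | yes refl | yes refl = yes refl
... | no p | _ = no λ { refl → p refl }
... | yes _ | no q = no λ { refl → q refl }

subformulas : Formula → List Formula
subformulas (var x) = var x ∷ []
subformulas ⊥' = ⊥' ∷ []
subformulas (a ∧ b) = (a ∧ b) ∷ subformulas a ++ subformulas b
subformulas (a ∨ b) = (a ∨ b) ∷ subformulas a ++ subformulas b
subformulas (a ⊃ b) = (a ⊃ b) ∷ subformulas a ++ subformulas b

data IsVar : Formula → Set where
  isVar : ∀ x → IsVar (var x)

data IsVar⊥ : Formula → Set where
  isVar : ∀ x → IsVar⊥ (var x)
  isBot : IsVar⊥ ⊥'

data IsImp : Formula → Set where
  isImp : ∀ A B → IsImp (A ⊃ B)

isVarᵇ : Formula → Bool
isVarᵇ (var _) = true
isVarᵇ _ = false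

isImpᵇ : Formula → Bool
isImpᵇ (_ ⊃ _) = true
isImpᵇ _ = false

data Cl (P : Formula → Set) : Formula → Set where
  base : ∀ {X} → P X → Cl P X
  cl∧  : ∀ {X Y} → Cl P X → Cl P Y → Cl P (X ∧ Y)
  cl∨ˡ : ∀ {X} A → Cl P X → Cl P (A ∨ X)
  cl∨ʳ : ∀ {X} A → Cl P X → Cl P (X ∨ A)
  cl⊃  : ∀ {X} A → Cl P X → Cl P (A ⊃ X)

module FRJ (G : Formula) where

  mutual
    data Sl : Formula → Set where
      sl∧₁ : ∀ {A B} → Sl (A ∧ B) → Sl A
      sl∧₂ : ∀ {A B} → Sl (A ∧ B) → Sl B
      sl∨₁ : ∀ {A B} → Sl (A ∨ B) → Sl A
      sl∨₂ : ∀ {A B} → Sl (A ∨ B) → Sl B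
      sl⊃  : ∀ {A B} → Sl (A ⊃ B) → Sl B
      sr⊃  : ∀ {A B} → Sr (A ⊃ B) → Sl A

    data Sr : Formula → Set where
      srG  : Sr G
      sr∧₁ : ∀ {A B} → Sr (A ∧ B) → Sr A
      sr∧₂ : ∀ {A B} → Sr (A ∧ B) → Sr B
      sr∨₁ : ∀ {A B} → Sr (A ∨ B) → Sr A
      sr∨₂ : ∀ {A B} → Sr (A ∨ B) → Sr B
      sr⊃  : ∀ {A B} → Sr (A ⊃ B) → Sr B
      sl⊃  : ∀ {A B} → Sl (A ⊃ B) → Sr A

  InΓ̄ : Formula → Set
  InΓ̄ A = Sl A × (IsVar A ⊎ IsImp A)

  -- Sets of formulas occurring in sequents are subsets of Γ̄ ⊆ subformulas of G.
  -- They are represented canonically as subsets (bit vectors) of a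
  -- duplicate-free enumeration of the subformulas of G.
  U : List Formula
  U = deduplicate _≟F_ (subformulas G)

  N : ℕ
  N = length U

  el : Fin N → Formula
  el = lookup U

  FSet : Set
  FSet = Subset N

  infix 4 _∈ₛ_
  _∈ₛ_ : Formula → FSet → Set
  A ∈ₛ Γ = ∃[ i ] (el i ≡ A × i S.∈ Γ)

  ∅ : FSet
  ∅ = S.⊥

  atomsS : FSet
  atomsS = Data.Vec.tabulate (λ i → if isVarᵇ (el i) then inside else outside)
    where import Data.Vec

  impsS : FSet
  impsS = Data.Vec.tabulate (λ i → if isImpᵇ (el i) then inside else outside)
    where import Data.Vec

  without : FSet → Formula → FSet
  without Γ F = Data.Vec.tabulate (λ i → remove (el i ≟F F) (Data.Vec.lookup Γ i))
    where
    import Data.Vec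
    remove : ∀ {P : Set} → Relation.Nullary.Dec P → S.Side → S.Side
    remove (yes _) _ = outside
    remove (no _) s = s

  Exactly : FSet → (Formula → Set) → Set
  Exactly Γ P = ∀ i → (i S.∈ Γ → P (el i)) × (P (el i) → i S.∈ Γ)

  ClS : FSet → Formula → Set
  ClS Γ = Cl (λ A → A ∈ₛ Γ)

  ⊆ClΓ̄ : FSet → FSet → Set
  ⊆ClΓ̄ Θ Γ = ∀ i → i S.∈ Θ → ClS Γ (el i) × InΓ̄ (el i)

  Disjoint : FSet → FSet → Set
  Disjoint Θ Λ = ∀ i → i S.∈ Θ → i S.∈ Λ → Empty

  -- proper subset (sets are canonical, so ≢ is set inequality)
  _⊊_ : FSet → FSet → Set
  X ⊊ Y = X S.⊆ Y × X ≢ Y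

  data Seq : Set where
    _⇒_   : FSet → Formula → Seq
    _︔_⟶_ : FSet → FSet → Formula → Seq

  ⊆Γ̄ : FSet → Set
  ⊆Γ̄ Γ = ∀ i → i S.∈ Γ → InΓ̄ (el i)

  WFSeq : Seq → Set
  WFSeq (Γ ⇒ C) = ⊆Γ̄ Γ × Sr C
  WFSeq (Σ' ︔ Θ ⟶ C) = ⊆Γ̄ Σ' × ⊆Γ̄ Θ × Sr C

  InΥ : ∀ {m} → (Fin m → Formula) → Formula → Set
  InΥ As Y = ∃[ j ] (As j ≡ Y)

  ⋃ⱼ : ∀ {m} → (Fin m → FSet) → FSet
  ⋃ⱼ {m} f = S.⋃ (map f (allFin m))

  ⋂ⱼ : ∀ {m} → (Fin m → FSet) → FSet
  ⋂ⱼ {m} f = S.⋂ (map f (allFin m))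

  data Derivable : Seq → Set where
    ax-reg : ∀ {Γ F} → IsVar⊥ F →
      Exactly Γ (λ A → Sl A × IsVar A × A ≢ F) →
      WFSeq (Γ ⇒ F) → Derivable (Γ ⇒ F)
    ax-irr : ∀ {Θ F} → IsVar⊥ F →
      Exactly Θ (λ A → Sl A × ((IsVar A × A ≢ F) ⊎ IsImp A)) →
      WFSeq (∅ ︔ Θ ⟶ F) → Derivable (∅ ︔ Θ ⟶ F)
    ∧₁-reg : ∀ {Γ A₁ A₂} → Derivable (Γ ⇒ A₁) →
      WFSeq (Γ ⇒ (A₁ ∧ A₂)) → Derivable (Γ ⇒ (A₁ ∧ A₂))
    ∧₂-reg : ∀ {Γ A₁ A₂} → Derivable (Γ ⇒ A₂) →
      WFSeq (Γ ⇒ (A₁ ∧ A₂)) → Derivable (Γ ⇒ (A₁ ∧ A₂))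
    ∧₁-irr : ∀ {Σ' Θ A₁ A₂} → Derivable (Σ' ︔ Θ ⟶ A₁) →
      WFSeq (Σ' ︔ Θ ⟶ (A₁ ∧ A₂)) → Derivable (Σ' ︔ Θ ⟶ (A₁ ∧ A₂))
    ∧₂-irr : ∀ {Σ' Θ A₁ A₂} → Derivable (Σ' ︔ Θ ⟶ A₂) →
      WFSeq (Σ' ︔ Θ ⟶ (A₁ ∧ A₂)) → Derivable (Σ' ︔ Θ ⟶ (A₁ ∧ A₂))
    ∨-irr : ∀ {Σ₁ Θ₁ C₁ Σ₂ Θ₂ C₂} →
      Derivable (Σ₁ ︔ Θ₁ ⟶ C₁) → Derivable (Σ₂ ︔ Θ₂ ⟶ C₂) →
      Σ₁ S.⊆ (Σ₂ S.∪ Θ₂) → Σ₂ S.⊆ (Σ₁ S.∪ Θ₁) →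
      WFSeq ((Σ₁ S.∪ Σ₂) ︔ (Θ₁ S.∩ Θ₂) ⟶ (C₁ ∨ C₂)) →
      Derivable ((Σ₁ S.∪ Σ₂) ︔ (Θ₁ S.∩ Θ₂) ⟶ (C₁ ∨ C₂))
    ⊃∈-reg : ∀ {Γ A B} → Derivable (Γ ⇒ B) → ClS Γ A →
      WFSeq (Γ ⇒ (A ⊃ B)) → Derivable (Γ ⇒ (A ⊃ B))
    ⊃∈-irr : ∀ {Σ' Θ Λ A B} → Derivable (Σ' ︔ (Θ S.∪ Λ) ⟶ B) →
      Disjoint Θ Λ → ClS (Σ' S.∪ Λ) A →
      (∀ Λ' → Λ' ⊊ Λ → ¬ ClS (Σ' S.∪ Λ') A) →
      WFSeq ((Σ' S.∪ Λ) ︔ Θ ⟶ (A ⊃ B)) →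
      Derivable ((Σ' S.∪ Λ) ︔ Θ ⟶ (A ⊃ B))
    ⊃∉ : ∀ {Γ Θ A B} → Derivable (Γ ⇒ B) →
      ⊆ClΓ̄ Θ Γ → ClS Γ A → ¬ ClS Θ A →
      (∀ Θ' → Θ ⊊ Θ' → ⊆ClΓ̄ Θ' Γ → ClS Θ' A) →
      WFSeq (∅ ︔ Θ ⟶ (A ⊃ B)) → Derivable (∅ ︔ Θ ⟶ (A ⊃ B))
    -- join rules, n = suc k ≥ 1 premises Σⱼ ; Θⱼ → Aⱼ
    ⋈At : ∀ {k} (Σs Θs : Fin (suc k) → FSet) (As : Fin (suc k) → Formula)
      (Θ⊃ : FSet) (F : Formula) →
      (∀ j → Derivable (Σs j ︔ Θs j ⟶ As j)) →
      (∀ i j → i ≢ j → Σs i S.⊆ (Σs j S.∪ Θs j)) →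
      (∀ Y Z → (Y ⊃ Z) ∈ₛ ⋃ⱼ (λ j → Σs j S.∩ impsS) → InΥ As Y) →
      Exactly Θ⊃ (λ X → X ∈ₛ ⋂ⱼ (λ j → Θs j S.∩ impsS) ×
                        ∃[ Y ] ∃[ Z ] (X ≡ (Y ⊃ Z) × InΥ As Y)) →
      IsVar⊥ F → ¬ (F ∈ₛ ⋃ⱼ (λ j → Σs j S.∩ atomsS)) →
      (∀ j → ∃[ Z ] Sl (As j ⊃ Z)) →
      WFSeq ((⋃ⱼ (λ j → Σs j S.∩ atomsS) S.∪
              without (⋂ⱼ (λ j → Θs j S.∩ atomsS)) F S.∪
              ⋃ⱼ (λ j → Σs j S.∩ impsS) S.∪ Θ⊃) ⇒ F) →
      Derivable ((⋃ⱼ (λ j → Σs j S.∩ atomsS) S.∪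
              without (⋂ⱼ (λ j → Θs j S.∩ atomsS)) F S.∪
              ⋃ⱼ (λ j → Σs j S.∩ impsS) S.∪ Θ⊃) ⇒ F)
    ⋈∨ : ∀ {k} (Σs Θs : Fin (suc k) → FSet) (As : Fin (suc k) → Formula)
      (Θ⊃ : FSet) (C₁ C₂ : Formula) →
      (∀ j → Derivable (Σs j ︔ Θs j ⟶ As j)) →
      (∀ i j → i ≢ j → Σs i S.⊆ (Σs j S.∪ Θs j)) →
      (∀ Y Z → (Y ⊃ Z) ∈ₛ ⋃ⱼ (λ j → Σs j S.∩ impsS) → InΥ As Y) →
      Exactly Θ⊃ (λ X → X ∈ₛ ⋂ⱼ (λ j → Θs j S.∩ impsS) ×
                        ∃[ Y ] ∃[ Z ] (X ≡ (Y ⊃ Z) × InΥ As Y)) →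
      InΥ As C₁ → InΥ As C₂ →
      (∀ j → ∃[ Z ] (Sl (As j ⊃ Z) ⊎ Sr (As j ∨ Z) ⊎ Sr (Z ∨ As j))) →
      WFSeq ((⋃ⱼ (λ j → Σs j S.∩ atomsS) S.∪
              ⋂ⱼ (λ j → Θs j S.∩ atomsS) S.∪
              ⋃ⱼ (λ j → Σs j S.∩ impsS) S.∪ Θ⊃) ⇒ (C₁ ∨ C₂)) →
      Derivable ((⋃ⱼ (λ j → Σs j S.∩ atomsS) S.∪
              ⋂ⱼ (λ j → Θs j S.∩ atomsS) S.∪
              ⋃ⱼ (λ j → Σs j S.∩ impsS) S.∪ Θ⊃) ⇒ (C₁ ∨ C₂))

  data _⊑_ : Seq → Seq → Set where
    ⊑-reg : ∀ {Γ₁ Γ₂ C} → Γ₁ S.⊆ Γ₂ → (Γ₁ ⇒ C) ⊑ (Γ₂ ⇒ C)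
    ⊑-irr : ∀ {Σ' Θ₁ Θ₂ C} → Θ₁ S.⊆ Θ₂ → (Σ' ︔ Θ₁ ⟶ C) ⊑ (Σ' ︔ Θ₂ ⟶ C)

  _⊏_ : Seq → Seq → Set
  σ₁ ⊏ σ₂ = σ₁ ⊑ σ₂ × σ₁ ≢ σ₂

  IsDatabase : (Seq → Set) → Set
  IsDatabase DB = ∀ σ → DB σ → Derivable σ

  Saturated : (Seq → Set) → Set
  Saturated DB = ∀ σ → Derivable σ → ∃[ σ' ] (DB σ' × σ ⊑ σ')

  Compact : (Seq → Set) → Set
  Compact DB = ∀ σ σ' → DB σ → DB σ' → ¬ (σ' ⊏ σ)

  _⊆DB_ : (Seq → Set) → (Seq → Set) → Set
  DB₁ ⊆DB DB₂ = ∀ σ → DB₁ σ → DB₂ σ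

module Submission where

open import Defs
open import Data.Product using (_,_)
open import Data.Sum using (_⊎_; inj₁; inj₂)
open import Relation.Binary.PropositionalEquality using (_≡_; refl; subst; sym; cong)
open import Relation.Nullary using (Dec; yes; no)
open import Data.Bool.Properties using () renaming (_≟_ to _≟B_)
open import Data.Vec.Properties using (≡-dec)
open import Data.Fin.Subset.Properties using (⊆-antisym; ⊆-trans)

-- Given σ ∈ DB¹, saturation of DB² gives σ ⊑ σ' ∈ DB², and saturation of DB¹
-- then gives σ' ⊑ σ'' ∈ DB¹. Compactness forces σ = σ'', so σ ⊑ σ' ⊑ σ and
-- antisymmetry of ⊑ yields σ = σ' ∈ DB².

module _ (G : Formula) where
  open FRJ G

  _≟ₛ_ : (Γ Δ : FSet) → Dec (Γ ≡ Δ)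
  _≟ₛ_ = ≡-dec _≟B_

  ⊑-trans : ∀ {σ₁ σ₂ σ₃} → σ₁ ⊑ σ₂ → σ₂ ⊑ σ₃ → σ₁ ⊑ σ₃
  ⊑-trans (⊑-reg p) (⊑-reg q) = ⊑-reg (⊆-trans p q)
  ⊑-trans (⊑-irr p) (⊑-irr q) = ⊑-irr (⊆-trans p q)

  ⊑-antisym : ∀ {σ₁ σ₂} → σ₁ ⊑ σ₂ → σ₂ ⊑ σ₁ → σ₁ ≡ σ₂
  ⊑-antisym (⊑-reg p) (⊑-reg q) = cong (_⇒ _) (⊆-antisym p q)
  ⊑-antisym (⊑-irr p) (⊑-irr q) = cong (λ Θ → _ ︔ Θ ⟶ _) (⊆-antisym p q)

  ⊑⇒≡⊎⊏ : ∀ {σ₁ σ₂} → σ₁ ⊑ σ₂ → σ₁ ≡ σ₂ ⊎ σ₁ ⊏ σ₂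
  ⊑⇒≡⊎⊏ σ₁⊑σ₂@(⊑-reg {Γ₁} {Γ₂} _) with Γ₁ ≟ₛ Γ₂
  ... | yes refl = inj₁ refl
  ... | no Γ₁≢Γ₂ = inj₂ (σ₁⊑σ₂ , λ { refl → Γ₁≢Γ₂ refl })
  ⊑⇒≡⊎⊏ σ₁⊑σ₂@(⊑-irr {_} {Θ₁} {Θ₂} _) with Θ₁ ≟ₛ Θ₂
  ... | yes refl = inj₁ refl
  ... | no Θ₁≢Θ₂ = inj₂ (σ₁⊑σ₂ , λ { refl → Θ₁≢Θ₂ refl })

  compact-⊑⇒≡ : ∀ {DB σ₁ σ₂} → Compact DB → DB σ₁ → DB σ₂ → σ₁ ⊑ σ₂ → σ₁ ≡ σ₂
  compact-⊑⇒≡ compact σ₁∈DB σ₂∈DB σ₁⊑σ₂ with ⊑⇒≡⊎⊏ σ₁⊑σ₂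
  ... | inj₁ σ₁≡σ₂ = σ₁≡σ₂
  ... | inj₂ σ₁⊏σ₂ with () ← compact _ _ σ₂∈DB σ₁∈DB σ₁⊏σ₂

  compact-⊑-sandwich : ∀ {DB σ₁ σ₂ σ₃} → Compact DB → DB σ₁ → DB σ₃ →
    σ₁ ⊑ σ₂ → σ₂ ⊑ σ₃ → σ₁ ≡ σ₂
  compact-⊑-sandwich compact σ₁∈DB σ₃∈DB σ₁⊑σ₂ σ₂⊑σ₃
    with refl ← compact-⊑⇒≡ compact σ₁∈DB σ₃∈DB (⊑-trans σ₁⊑σ₂ σ₂⊑σ₃)
    = ⊑-antisym σ₁⊑σ₂ σ₂⊑σ₃

lemma4p3 : (G : Formula) (DB¹ : FRJ.Seq G → Set) →
    FRJ.IsDatabase G DB¹ → FRJ.Compact G DB¹ → FRJ.Saturated G DB¹ →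
    (DB² : FRJ.Seq G → Set) → FRJ.IsDatabase G DB² → FRJ.Saturated G DB² →
    FRJ._⊆DB_ G DB¹ DB²
lemma4p3 G DB¹ sound¹ compact¹ saturated¹ DB² sound² saturated² σ σ∈DB¹
  with σ' , σ'∈DB² , σ⊑σ' ← saturated² σ (sound¹ σ σ∈DB¹)
  with σ'' , σ''∈DB¹ , σ'⊑σ'' ← saturated¹ σ' (sound² σ' σ'∈DB²)
  = subst DB² (sym (compact-⊑-sandwich G compact¹ σ∈DB¹ σ''∈DB¹ σ⊑σ' σ'⊑σ'')) σ'∈DB²
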